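{- Let $I=(n,m,X_1,\ldots,X_m,\tau_0)$ be an instance such that each $X_j$ is of the form $\{k_j,k_j+1\}$ with $k_j\in[n-1]$, and suppose there exist $\tau_1,\ldots,\tau_m\in\mathcal{S}_n$ with $\tau_m=\mathrm{id}$ and $\tau_{j-1}\xrightarrow{X_j}\tau_j$ for all $j\in[m]$ (i.e., $I$ is a YES-instance of V2-WPPSG$_0[2]$). Then the sorting strategy is successful on $I$, i.e., the permutation $\tau_m$ it produces equals $\mathrm{id}=(1,\ldots,n)$.
   Context: $[n]=\{1,\ldots,n\}$; $\mathcal{S}_n$ is the symmetric group on $[n]$, the image of $i$ under $\tau$ is $i\tau$, and $\tau$ is identified with the tuple $(1\tau,\ldots,n\tau)$. For $X\subseteq[n]$, $\tau'\xrightarrow{X}\tau$ means $i\tau=i\tau'$ for all $i\in[n]\setminus X$. A permutation $\tau$ is $X$-sorted if $i\tau<j\tau$ for all $i<j$ in $X$; each $\xrightarrow{X}$-class contains exactly one $X$-sorted permutation. The sorting strategy applied to $\tau_0$ and $X_1,\ldots,X_m$ defines, for $j=1,\ldots,m$, $\tau_j$ as the unique $X_j$-sorted permutation that coincides with $\tau_{j-1}$ outside $X_j$; it is successful if the final $\tau_m$ is the identity. -}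

module Defs where

open import Data.Nat using (ℕ; suc; _<_)
open import Data.Fin using (Fin; toℕ) renaming (_<_ to _<ᶠ_)
open import Data.Fin.Permutation using (Permutation′; _⟨$⟩ʳ_)
open import Relation.Binary.PropositionalEquality using (_≡_)
open import Relation.Nullary using (¬_)

Subset : ℕ → Set₁
Subset n = Fin n → Set

app : ∀ {n} → Permutation′ n → Fin n → Fin n
app τ i = τ ⟨$⟩ʳ i

Arrow : ∀ {n} → Subset n → Permutation′ n → Permutation′ n → Set
Arrow {n} X τ' τ = (i : Fin n) → ¬ X i → app τ i ≡ app τ' i

Sorted : ∀ {n} → Subset n → Permutation′ n → Set
Sorted {n} X τ = (i j : Fin n) → X i → X j → i <ᶠ j → app τ i <ᶠ app τ j

IsId : ∀ {n} → Permutation′ n → Set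
IsId {n} τ = (i : Fin n) → app τ i ≡ i

Adjacent : (n : ℕ) → (k : Fin n) → Subset n
Adjacent n k i = (toℕ i ≡ toℕ k) ⊎' (toℕ i ≡ suc (toℕ k))
  where
  open import Data.Sum using () renaming (_⊎_ to _⊎'_)

_≗ₚ_ : ∀ {n} → Permutation′ n → Permutation′ n → Set
_≗ₚ_ {n} σ τ = (i : Fin n) → app σ i ≡ app τ i

module Submission where

-- Compare the run σ of the sorting strategy with the witness run τ in the dominance order:
-- σ ≼ ρ when, for every t and i, σ puts at most as many values ≥ t into its first i
-- positions as ρ. A step on the pair {k, k+1} can change these
-- counts only for i = k+1, and there the sorted order of the pair is the smallest possible,
-- so σⱼ ≼ τⱼ is preserved. Finally τₘ = id puts no value ≥ a+1 into its first a+1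
-- positions, hence σₘ(a) ≤ a for every a, which forces σₘ = id.

open import Defs
open import Data.Nat.Properties
open import Algebra.Properties.CommutativeMonoid.Sum +-0-commutativeMonoid
  using (sum; sum-cong-≗; sum-remove; sum-permute; ∑-distrib-+; sum-replicate-zero)
open import Data.Bool using (Bool; true; false; _∧_; T)
open import Data.Empty using (⊥-elim)
open import Data.Fin using (Fin; toℕ; zero; suc; inject₁; fromℕ; fromℕ<; punchIn)
  renaming (_<_ to _<ᶠ_)
open import Data.Fin.Induction using (<-weakInduction; <-wellFounded)
open import Data.Fin.Permutation using (Permutation′)
open import Data.Fin.Properties using (toℕ-injective; toℕ-fromℕ<; punchInᵢ≢i)
open import Data.Nat
  using (ℕ; suc; _+_; _≤_; _<_; s≤s⁻¹; z≤n; _≤?_; _<?_; _<ᵇ_; _≤ᵇ_; _≟_)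
open import Data.Product using (Σ; _×_; _,_; proj₁; proj₂)
open import Data.Sum using (inj₁; inj₂)
open import Data.Unit using (tt)
open import Data.Vec.Functional using (removeAt)
open import Function using (_∘_)
open import Function.Bundles using (Injection)
open import Function.Properties.Inverse using (↔⇒↣)
open import Induction.WellFounded using (Acc; acc)
open import Relation.Binary.Definitions using (tri<; tri≈; tri>)
open import Relation.Binary.PropositionalEquality
  using (_≡_; _≢_; refl; sym; trans; cong; cong₂; subst; subst₂; module ≡-Reasoning)
open import Relation.Nullary using (¬_; yes; no)
open import Relation.Nullary.Decidable using (dec-true; dec-false)
open import Relation.Nullary.Reflects using (ofʸ; ofⁿ)

𝟙 : Bool → ℕ
𝟙 true  = 1
𝟙 false = 0

𝟙≤1 : ∀ b → 𝟙 b ≤ 1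
𝟙≤1 true  = ≤-refl
𝟙≤1 false = z≤n

count : ∀ {n} → (Fin n → Bool) → ℕ
count b = sum (𝟙 ∘ b)

count-∧-cong : ∀ {n} (p : Fin n → Bool) {b c : Fin n → Bool} →
  (∀ x → T (p x) → b x ≡ c x) → count (λ x → p x ∧ b x) ≡ count (λ x → p x ∧ c x)
count-∧-cong p {b} {c} b≡c = sum-cong-≗ pointwise
  where
  pointwise : ∀ x → 𝟙 (p x ∧ b x) ≡ 𝟙 (p x ∧ c x)
  pointwise x with p x in px
  ... | true  = cong 𝟙 (b≡c x (subst T (sym px) tt))
  ... | false = refl

prefixCount : ∀ {n} → (Fin n → Bool) → ℕ → ℕ
prefixCount b i = count (λ x → (toℕ x <ᵇ i) ∧ b x)

suffixCount : ∀ {n} → (Fin n → Bool) → ℕ → ℕ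
suffixCount b i = count (λ x → (i ≤ᵇ toℕ x) ∧ b x)

prefixCount+suffixCount : ∀ {n} (b : Fin n → Bool) i →
  prefixCount b i + suffixCount b i ≡ count b
prefixCount+suffixCount b i =
  trans (sym (∑-distrib-+ (λ x → 𝟙 ((toℕ x <ᵇ i) ∧ b x)) (λ x → 𝟙 ((i ≤ᵇ toℕ x) ∧ b x))))
        (sum-cong-≗ pointwise)
  where
  pointwise : ∀ x → 𝟙 ((toℕ x <ᵇ i) ∧ b x) + 𝟙 ((i ≤ᵇ toℕ x) ∧ b x) ≡ 𝟙 (b x)
  pointwise x with toℕ x <ᵇ i | <ᵇ-reflects-< (toℕ x) i | i ≤ᵇ toℕ x | ≤ᵇ-reflects-≤ i (toℕ x)
  ... | true  | ofʸ x<i | true  | ofʸ i≤x = ⊥-elim (<⇒≱ x<i i≤x)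
  ... | true  | _       | false | _       = +-identityʳ (𝟙 (b x))
  ... | false | _       | true  | _       = refl
  ... | false | ofⁿ x≮i | false | ofⁿ i≰x = ⊥-elim (i≰x (≮⇒≥ x≮i))

prefixCount-suc : ∀ {n} (b : Fin n → Bool) (x : Fin n) →
  prefixCount b (suc (toℕ x)) ≡ 𝟙 (b x) + prefixCount b (toℕ x)
prefixCount-suc {suc _} b x = begin
  prefixCount b (suc (toℕ x))              ≡⟨ sum-remove {i = x} f₁ ⟩
  f₁ x + sum (removeAt f₁ x)               ≡⟨ cong₂ _+_ f₁x≡bx (cong₂ _+_ (sym f₀x≡0) removed-equal) ⟩
  𝟙 (b x) + (f₀ x + sum (removeAt f₀ x))   ≡⟨ cong (𝟙 (b x) +_) (sum-remove {i = x} f₀) ⟨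
  𝟙 (b x) + prefixCount b (toℕ x)          ∎
  where
  open ≡-Reasoning
  f₁ f₀ : Fin _ → ℕ
  f₁ y = 𝟙 ((toℕ y <ᵇ suc (toℕ x)) ∧ b y)
  f₀ y = 𝟙 ((toℕ y <ᵇ toℕ x) ∧ b y)
  f₁x≡bx : f₁ x ≡ 𝟙 (b x)
  f₁x≡bx rewrite dec-true (toℕ x <? suc (toℕ x)) ≤-refl = refl
  f₀x≡0 : f₀ x ≡ 0
  f₀x≡0 rewrite dec-false (toℕ x <? toℕ x) (<-irrefl refl) = refl
  f₁≡f₀ : ∀ y → y ≢ x → f₁ y ≡ f₀ y
  f₁≡f₀ y y≢x with toℕ y <ᵇ suc (toℕ x) | <ᵇ-reflects-< (toℕ y) (suc (toℕ x))
                 | toℕ y <ᵇ toℕ x | <ᵇ-reflects-< (toℕ y) (toℕ x)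
  ... | true  | ofʸ y≤x | false | ofⁿ y≮x = ⊥-elim (y≮x (≤∧≢⇒< (≤-pred y≤x) (y≢x ∘ toℕ-injective)))
  ... | false | ofⁿ y≰x | true  | ofʸ y<x = ⊥-elim (y≰x (m<n⇒m<1+n y<x))
  ... | true  | _       | true  | _       = refl
  ... | false | _       | false | _       = refl
  removed-equal : sum (removeAt f₁ x) ≡ sum (removeAt f₀ x)
  removed-equal = sum-cong-≗ λ z → f₁≡f₀ (punchIn x z) (punchInᵢ≢i x z)

prefixCount-≤-at-sorted-pair : ∀ {n} {b c : Fin n → Bool} (k k′ : Fin n) → toℕ k′ ≡ suc (toℕ k) →
  (T (b k) → T (b k′)) →
  prefixCount b (toℕ k) ≤ prefixCount c (toℕ k) →
  prefixCount b (suc (toℕ k′)) ≤ prefixCount c (suc (toℕ k′)) →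
  prefixCount b (toℕ k′) ≤ prefixCount c (toℕ k′)
prefixCount-≤-at-sorted-pair {b = b} {c} k k′ k′≡k+1 sorted ≤-at-k ≤-after-k′
  with b k in bk
... | false = begin
  prefixCount b (toℕ k′)           ≡⟨ step b ⟩
  𝟙 (b k) + prefixCount b (toℕ k)  ≡⟨ cong (λ v → 𝟙 v + prefixCount b (toℕ k)) bk ⟩
  prefixCount b (toℕ k)            ≤⟨ ≤-at-k ⟩
  prefixCount c (toℕ k)            ≤⟨ m≤n+m _ (𝟙 (c k)) ⟩
  𝟙 (c k) + prefixCount c (toℕ k)  ≡⟨ step c ⟨
  prefixCount c (toℕ k′)           ∎
  where
  open ≤-Reasoning
  step : ∀ d → prefixCount d (toℕ k′) ≡ 𝟙 (d k) + prefixCount d (toℕ k)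
  step d = trans (cong (prefixCount d) k′≡k+1) (prefixCount-suc d k)
... | true = s≤s⁻¹ (begin
  suc (prefixCount b (toℕ k′))           ≡⟨ cong (λ v → 𝟙 v + prefixCount b (toℕ k′)) bk′ ⟨
  𝟙 (b k′) + prefixCount b (toℕ k′)      ≡⟨ prefixCount-suc b k′ ⟨
  prefixCount b (suc (toℕ k′))           ≤⟨ ≤-after-k′ ⟩
  prefixCount c (suc (toℕ k′))           ≡⟨ prefixCount-suc c k′ ⟩
  𝟙 (c k′) + prefixCount c (toℕ k′)      ≤⟨ +-monoˡ-≤ _ (𝟙≤1 (c k′)) ⟩
  suc (prefixCount c (toℕ k′))           ∎)
  where
  open ≤-Reasoning
  bk′ : b k′ ≡ true
  bk′ with b k′ | sorted tt
  ... | true | _ = refl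

above : ∀ {n} → ℕ → Permutation′ n → Fin n → Bool
above t σ x = t ≤ᵇ toℕ (app σ x)

count-above-≡ : ∀ {n} t (σ τ : Permutation′ n) → count (above t σ) ≡ count (above t τ)
count-above-≡ t σ τ = trans (sym (sum-permute f σ)) (sum-permute f τ)
  where
  f : Fin _ → ℕ
  f v = 𝟙 (t ≤ᵇ toℕ v)

¬Adjacent-below : ∀ {n} {k x : Fin n} → toℕ x < toℕ k → ¬ Adjacent n k x
¬Adjacent-below x<k (inj₁ x≡k)   = <-irrefl x≡k x<k
¬Adjacent-below x<k (inj₂ x≡k+1) = <-irrefl x≡k+1 (<-trans x<k (n<1+n _))

¬Adjacent-above : ∀ {n} {k x : Fin n} → suc (toℕ k) < toℕ x → ¬ Adjacent n k x
¬Adjacent-above k+1<x (inj₁ x≡k)   = <-irrefl (sym x≡k) (<-trans (n<1+n _) k+1<x)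
¬Adjacent-above k+1<x (inj₂ x≡k+1) = <-irrefl (sym x≡k+1) k+1<x

prefixCount-above-unchanged : ∀ {n} {k : Fin n} {σ σ′ : Permutation′ n} → Arrow (Adjacent n k) σ σ′ →
  ∀ t i → i ≢ suc (toℕ k) → prefixCount (above t σ′) i ≡ prefixCount (above t σ) i
prefixCount-above-unchanged {n} {k} {σ} {σ′} σ→σ′ t i i≢k+1 with <-cmp i (suc (toℕ k))
... | tri< i<k+1 _ _ = count-∧-cong (λ x → toℕ x <ᵇ i) λ x x<i →
  agree x (¬Adjacent-below (<-≤-trans (<ᵇ⇒< _ _ x<i) (s≤s⁻¹ i<k+1)))
  where
  agree : ∀ x → ¬ Adjacent n k x → above t σ′ x ≡ above t σ x
  agree x x∉X = cong (λ v → t ≤ᵇ toℕ v) (σ→σ′ x x∉X)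
... | tri≈ _ i≡k+1 _ = ⊥-elim (i≢k+1 i≡k+1)
-- Past the pair, compare suffixes instead: the suffixes agree, and every permutation
-- contains the same number of values ≥ t.
... | tri> _ _ k+1<i = +-cancelʳ-≡ (suffixCount (above t σ) i) _ _ (begin
  prefixCount b′ i + suffixCount b i   ≡⟨ cong (prefixCount b′ i +_) suffixCount-equal ⟨
  prefixCount b′ i + suffixCount b′ i  ≡⟨ prefixCount+suffixCount b′ i ⟩
  count b′                             ≡⟨ count-above-≡ t σ′ σ ⟩
  count b                              ≡⟨ prefixCount+suffixCount b i ⟨
  prefixCount b i + suffixCount b i    ∎)
  where
  open ≡-Reasoning
  b b′ : Fin n → Bool
  b = above t σ
  b′ = above t σ′
  suffixCount-equal : suffixCount b′ i ≡ suffixCount b i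
  suffixCount-equal = count-∧-cong (λ x → i ≤ᵇ toℕ x) λ x i≤x →
    cong (λ v → t ≤ᵇ toℕ v) (σ→σ′ x (¬Adjacent-above (<-≤-trans k+1<i (≤ᵇ⇒≤ _ _ i≤x))))

record _≼_ {n} (σ ρ : Permutation′ n) : Set where
  constructor dominated
  field
    prefixCount-above-≤ : ∀ t i → prefixCount (above t σ) i ≤ prefixCount (above t ρ) i

open _≼_

sortStep-preserves-≼ : ∀ {n} (k k′ : Fin n) → toℕ k′ ≡ suc (toℕ k) → {σ σ′ ρ ρ′ : Permutation′ n} →
  σ ≼ ρ → Arrow (Adjacent n k) σ σ′ → Sorted (Adjacent n k) σ′ → Arrow (Adjacent n k) ρ ρ′ →
  σ′ ≼ ρ′
sortStep-preserves-≼ k k′ k′≡k+1 {σ} {σ′} {ρ} {ρ′} σ≼ρ σ→σ′ σ′-sorted ρ→ρ′ = dominated at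
  where
  away : ∀ t i → i ≢ suc (toℕ k) → prefixCount (above t σ′) i ≤ prefixCount (above t ρ′) i
  away t i i≢k+1 = subst₂ _≤_
    (sym (prefixCount-above-unchanged {k = k} {σ} {σ′} σ→σ′ t i i≢k+1))
    (sym (prefixCount-above-unchanged {k = k} {ρ} {ρ′} ρ→ρ′ t i i≢k+1))
    (prefixCount-above-≤ σ≼ρ t i)
  k<k′ : toℕ k < toℕ k′
  k<k′ = subst (toℕ k <_) (sym k′≡k+1) (n<1+n _)
  sorted-pair : ∀ t → T (above t σ′ k) → T (above t σ′ k′)
  sorted-pair t t≤σ′k = ≤⇒≤ᵇ {t} (≤-trans (≤ᵇ⇒≤ t _ t≤σ′k)
    (<⇒≤ (σ′-sorted k k′ (inj₁ refl) (inj₂ k′≡k+1) k<k′)))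
  at : ∀ t i → prefixCount (above t σ′) i ≤ prefixCount (above t ρ′) i
  at t i with i ≟ suc (toℕ k)
  ... | no i≢k+1 = away t i i≢k+1
  ... | yes refl = subst (λ j → prefixCount (above t σ′) j ≤ prefixCount (above t ρ′) j) k′≡k+1
    (prefixCount-≤-at-sorted-pair k k′ k′≡k+1 (sorted-pair t)
      (away t (toℕ k) (<⇒≢ (n<1+n _)))
      (away t (suc (toℕ k′)) (λ e → <⇒≢ k<k′ (sym (suc-injective e)))))

≼-id⇒nonIncreasing : ∀ {n} {σ ρ : Permutation′ n} → σ ≼ ρ → IsId ρ → ∀ x → toℕ (app σ x) ≤ toℕ x
≼-id⇒nonIncreasing {n} {σ} {ρ} σ≼ρ ρ-id x = ≮⇒≥ λ x<σx → n≮0 (begin-strict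
  0                                                  <⟨ n<1+n 0 ⟩
  1                                                  ≡⟨ cong 𝟙 (dec-true (a ≤? toℕ (app σ x)) x<σx) ⟨
  𝟙 (above a σ x)                                    ≤⟨ m≤m+n _ _ ⟩
  𝟙 (above a σ x) + prefixCount (above a σ) (toℕ x)  ≡⟨ prefixCount-suc (above a σ) x ⟨
  prefixCount (above a σ) a                          ≤⟨ prefixCount-above-≤ σ≼ρ a a ⟩
  prefixCount (above a ρ) a                          ≡⟨ sum-cong-≗ nothing-above ⟩
  sum {n} (λ _ → 0)                                  ≡⟨ sum-replicate-zero n ⟩
  0                                                  ∎)
  where
  open ≤-Reasoning
  a = suc (toℕ x)
  nothing-above : ∀ y → 𝟙 ((toℕ y <ᵇ a) ∧ above a ρ y) ≡ 0
  nothing-above y rewrite ρ-id y with toℕ y <ᵇ a | <ᵇ-reflects-< (toℕ y) a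
  ... | false | _ = refl
  ... | true  | ofʸ y<a = cong 𝟙 (dec-false (a ≤? toℕ y) (<⇒≱ y<a))

nonIncreasing⇒IsId : ∀ {n} (σ : Permutation′ n) → (∀ x → toℕ (app σ x) ≤ toℕ x) → IsId σ
nonIncreasing⇒IsId σ σx≤x x = fixed x (<-wellFounded x)
  where
  fixed : ∀ x → Acc _<ᶠ_ x → app σ x ≡ x
  fixed x (acc rs) with toℕ (app σ x) ≟ toℕ x
  ... | yes σx≡x = toℕ-injective σx≡x
  ... | no σx≢x  = Injection.injective (↔⇒↣ σ) (fixed (app σ x) (rs (≤∧≢⇒< (σx≤x x) σx≢x)))

≗ₚ⇒≼ : ∀ {n} {σ ρ : Permutation′ n} → σ ≗ₚ ρ → σ ≼ ρ
≗ₚ⇒≼ σ≗ρ = dominated λ t i →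
  ≤-reflexive (count-∧-cong (λ x → toℕ x <ᵇ i) λ x _ → cong (λ v → t ≤ᵇ toℕ v) (σ≗ρ x))

theorem3p8 : (n m : ℕ) (k : Fin m → Fin n) → ((j : Fin m) → suc (toℕ (k j)) < n) →
    (τ₀ : Permutation′ n) →
    (Σ (Fin (suc m) → Permutation′ n) λ τ →
      (τ zero ≗ₚ τ₀) × IsId (τ (fromℕ m)) ×
      ((j : Fin m) → Arrow (Adjacent n (k j)) (τ (inject₁ j)) (τ (suc j)))) →
    (σ : Fin (suc m) → Permutation′ n) → σ zero ≗ₚ τ₀ →
    ((j : Fin m) → Arrow (Adjacent n (k j)) (σ (inject₁ j)) (σ (suc j))
                 × Sorted (Adjacent n (k j)) (σ (suc j))) →
    IsId (σ (fromℕ m))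
theorem3p8 n m k k+1<n τ₀ (τ , τ-start , τₘ-id , τ-steps) σ σ-start σ-steps =
  nonIncreasing⇒IsId (σ (fromℕ m)) (≼-id⇒nonIncreasing (σ≼τ (fromℕ m)) τₘ-id)
  where
  σ≼τ : ∀ j → σ j ≼ τ j
  σ≼τ = <-weakInduction (λ j → σ j ≼ τ j)
    (≗ₚ⇒≼ λ x → trans (σ-start x) (sym (τ-start x)))
    (λ j σⱼ≼τⱼ → sortStep-preserves-≼ (k j) (fromℕ< (k+1<n j)) (toℕ-fromℕ< (k+1<n j)) σⱼ≼τⱼ
      (proj₁ (σ-steps j)) (proj₂ (σ-steps j)) (τ-steps j))
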